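{- Let $(G,f,\pi)$ be a monotone SDS. (a) Suppose a state $X$ satisfies $X\le Z$ or $X\ge Z$ and reaches the fixed point $Z$ (i.e. $F_\pi^m(X)=Z=F_\pi(Z)$ for some $m\ge0$). Then every state $Y$ with $X\le Y\le Z$ or $X\ge Y\ge Z$ reaches the fixed point $Z$. (b) Suppose $X$ satisfies $X\le Z_\pi$ or $X\ge Z_\pi$ and reaches $Z_\pi$, where $Z_\pi$ is a fixed point of $(G,f,\pi)$. Then for every update schedule $\sigma$ and every $k\ge0$ we have $F_\sigma^k(X)\le Z_\pi$ or $F_\sigma^k(X)\ge Z_\pi$.
   Context: Let $G$ be a simple graph with vertex set $\{1,\dots,n\}$, each vertex having a state in $\mathbb{F}_2=\{0,1\}$; states are elements of $\mathbb{F}_2^n$. Each vertex $i$ has a local function $f_i$ of the states of $i$ and its neighbours; its inflation $F_i:\mathbb{F}_2^n\to\mathbb{F}_2^n$ replaces coordinate $i$ by this value and fixes other coordinates. For an update schedule (permutation) $\pi=\pi_1\cdots\pi_n$ of the vertices, $F_\pi=F_{\pi_n}\circ\cdots\circ F_{\pi_1}$; $(G,f,\pi)$ is an SDS, and $F^0_\pi$ is the identity. Order $\mathbb{F}_2^n$ componentwise with $0<1$; the SDS is monotone if each $f_i$ is monotone. A fixed point of $(G,f,\pi)$ is $Z$ with $F_\pi(Z)=Z$; $X$ reaches $Z$ if $F^m_\pi(X)=Z$ for some $m\ge 0$. -}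

module Defs where

open import Data.Nat using (ℕ; zero; suc)
open import Data.Bool using (Bool; true; false) renaming (_≤_ to _≤ᵇ_)
open import Data.Fin using (Fin)
open import Data.Fin.Permutation using (Permutation′; _⟨$⟩ʳ_)
open import Data.Vec using (Vec; lookup; _[_]≔_)
open import Data.List using (List; foldl; tabulate)
open import Data.Sum using (_⊎_)
open import Data.Empty using (⊥)
open import Relation.Nullary using (¬_)
open import Relation.Binary.PropositionalEquality using (_≡_)

-- States: elements of F₂ⁿ, with F₂ = Bool (false = 0, true = 1).
State : ℕ → Set
State n = Vec Bool n

_≤ₛ_ : ∀ {n} → State n → State n → Set
X ≤ₛ Y = ∀ i → lookup X i ≤ᵇ lookup Y i

record SimpleGraph (n : ℕ) : Set₁ where
  field
    Adj    : Fin n → Fin n → Set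
    sym    : ∀ {i j} → Adj i j → Adj j i
    irrefl : ∀ {i} → ¬ Adj i i

record LocalFunctions {n : ℕ} (G : SimpleGraph n) : Set where
  open SimpleGraph G
  field
    f     : Fin n → State n → Bool
    local : ∀ i (X Y : State n) →
            (∀ j → (j ≡ i ⊎ Adj i j) → lookup X j ≡ lookup Y j) →
            f i X ≡ f i Y

Monotone : ∀ {n} {G : SimpleGraph n} → LocalFunctions G → Set
Monotone {n} lf = ∀ i (X Y : State n) → X ≤ₛ Y →
                  LocalFunctions.f lf i X ≤ᵇ LocalFunctions.f lf i Y

module _ {n : ℕ} {G : SimpleGraph n} (lf : LocalFunctions G) where
  open LocalFunctions lf

  inflation : Fin n → State n → State n
  inflation i X = X [ i ]≔ f i X

  applyWord : List (Fin n) → State n → State n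
  applyWord w X = foldl (λ Y i → inflation i Y) X w

  -- F_π = F_{π_n} ∘ ⋯ ∘ F_{π_1}, π_k = π(k).
  sdsMap : Permutation′ n → State n → State n
  sdsMap π = applyWord (tabulate (π ⟨$⟩ʳ_))

iter : ∀ {A : Set} → (A → A) → ℕ → A → A
iter F zero    x = x
iter F (suc m) x = F (iter F m x)

-- A monotone SDS map F is order-preserving, so X ≤ Y ≤ Z gives F^m X ≤ F^m Y ≤ F^m Z;
-- when F^m X = Z = F^m Z this forces F^m Y = Z, which is (a).
-- For (b), a fixed point of F_π is fixed by every single inflation F_i (each vertex is
-- updated exactly once in π, and later updates do not touch it), hence by every F_σ;
-- monotonicity of F_σ then preserves comparability with it.
module Submission where

open import Defs
open import Data.Nat using (ℕ; zero; suc)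
open import Data.Bool.Properties using (≤-antisym)
open import Data.Fin.Properties using (_≟_)
open import Data.Fin.Permutation using (Permutation′; _⟨$⟩ʳ_; _⟨$⟩ˡ_; inverseʳ)
open import Data.Vec using (lookup; _[_]≔_)
import Data.Vec as Vec
open import Data.Vec.Properties using (lookup∘update; lookup∘update′; []≔-lookup; tabulate∘lookup; tabulate-cong)
open import Data.List using ([]; _∷_; tabulate)
open import Data.List.Relation.Unary.All using (All; []; _∷_)
open import Data.List.Relation.Unary.AllPairs using (_∷_)
open import Data.List.Relation.Unary.Any using (here; there)
open import Data.List.Relation.Unary.Unique.Propositional using (Unique)
open import Data.List.Relation.Unary.Unique.Propositional.Properties using (tabulate⁺)
open import Data.List.Membership.Propositional using (_∈_)
open import Data.List.Membership.Propositional.Properties using (∈-tabulate⁺)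
open import Data.Product using (_×_; ∃; _,_)
open import Data.Sum using (_⊎_; inj₁; inj₂)
import Data.Sum as Sum
open import Function using (_∘_; Injection)
open import Function.Properties.Inverse using (↔⇒↣)
open import Relation.Binary.Core using (Rel; _Preserves_⟶_)
open import Relation.Binary.PropositionalEquality
open import Relation.Nullary using (yes; no)

≤ₛ-antisym : ∀ {n} {X Y : State n} → X ≤ₛ Y → Y ≤ₛ X → X ≡ Y
≤ₛ-antisym {X = X} {Y} X≤Y Y≤X = begin
  X                       ≡⟨ tabulate∘lookup X ⟨
  Vec.tabulate (lookup X) ≡⟨ tabulate-cong (λ i → ≤-antisym (X≤Y i) (Y≤X i)) ⟩
  Vec.tabulate (lookup Y) ≡⟨ tabulate∘lookup Y ⟩
  Y                       ∎
  where open ≡-Reasoning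

iter-fixed : ∀ {A : Set} {F : A → A} {z : A} → F z ≡ z → ∀ k → iter F k z ≡ z
iter-fixed         Fz≡z zero    = refl
iter-fixed {F = F} Fz≡z (suc k) = trans (cong F (iter-fixed Fz≡z k)) Fz≡z

module _ {A : Set} {ℓ} {_∼_ : Rel A ℓ} {F : A → A} (F-mono : F Preserves _∼_ ⟶ _∼_) where

  iter-preserves : ∀ k → iter F k Preserves _∼_ ⟶ _∼_
  iter-preserves zero    x∼y = x∼y
  iter-preserves (suc k) {x} {y} x∼y = F-mono {iter F k x} {iter F k y} (iter-preserves k x∼y)

module _ {n} {F : State n → State n} (F-mono : F Preserves _≤ₛ_ ⟶ _≤ₛ_) where

  iter-mono : ∀ k → iter F k Preserves _≤ₛ_ ⟶ _≤ₛ_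
  iter-mono = iter-preserves {_∼_ = _≤ₛ_} F-mono

  iter-squeeze : ∀ k {X Y W Z} → X ≤ₛ Y → Y ≤ₛ W →
                 iter F k X ≡ Z → iter F k W ≡ Z → iter F k Y ≡ Z
  iter-squeeze k {X} {Y} {W} X≤Y Y≤W FᵏX≡Z FᵏW≡Z = ≤ₛ-antisym
    (subst (iter F k Y ≤ₛ_) FᵏW≡Z (iter-mono k Y≤W))
    (subst (_≤ₛ iter F k Y) FᵏX≡Z (iter-mono k X≤Y))

  iter-comparable-fixed : ∀ {X Z} → F Z ≡ Z → X ≤ₛ Z ⊎ Z ≤ₛ X →
                          ∀ k → iter F k X ≤ₛ Z ⊎ Z ≤ₛ iter F k X
  iter-comparable-fixed {X} {Z} FZ≡Z X∼Z k = Sum.map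
    (subst (iter F k X ≤ₛ_) (iter-fixed FZ≡Z k) ∘ iter-mono k)
    (subst (_≤ₛ iter F k X) (iter-fixed FZ≡Z k) ∘ iter-mono k)
    X∼Z

module _ {n} {G : SimpleGraph n} (lf : LocalFunctions G) where
  open LocalFunctions lf

  module _ (mono : Monotone lf) where

    inflation-mono : ∀ i → inflation lf i Preserves _≤ₛ_ ⟶ _≤ₛ_
    inflation-mono i {X} {Y} X≤Y j with j ≟ i
    ... | yes refl rewrite lookup∘update i X (f i X) | lookup∘update i Y (f i Y) = mono i X Y X≤Y
    ... | no j≢i rewrite lookup∘update′ j≢i X (f i X) | lookup∘update′ j≢i Y (f i Y) = X≤Y j

    applyWord-mono : ∀ w → applyWord lf w Preserves _≤ₛ_ ⟶ _≤ₛ_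
    applyWord-mono []      X≤Y = X≤Y
    applyWord-mono (i ∷ w) {X} {Y} X≤Y = applyWord-mono w (inflation-mono i {X} {Y} X≤Y)

    sdsMap-mono : ∀ σ → sdsMap lf σ Preserves _≤ₛ_ ⟶ _≤ₛ_
    sdsMap-mono σ = applyWord-mono (tabulate (σ ⟨$⟩ʳ_))

  lookup-applyWord-∉ : ∀ {i} w Y → All (i ≢_) w → lookup (applyWord lf w Y) i ≡ lookup Y i
  lookup-applyWord-∉ []      Y []          = refl
  lookup-applyWord-∉ (j ∷ w) Y (i≢j ∷ i∉w) =
    trans (lookup-applyWord-∉ w (inflation lf j Y) i∉w) (lookup∘update′ i≢j Y (f j Y))

  applyWord-fixed-head : ∀ {j w Z} → All (j ≢_) w → applyWord lf (j ∷ w) Z ≡ Z →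
                         inflation lf j Z ≡ Z
  applyWord-fixed-head {j} {w} {Z} j∉w fixed =
    trans (cong (Z [ j ]≔_) fjZ≡Zj) ([]≔-lookup Z j)
    where
    open ≡-Reasoning
    fjZ≡Zj : f j Z ≡ lookup Z j
    fjZ≡Zj = begin
      f j Z                                        ≡⟨ lookup∘update j Z (f j Z) ⟨
      lookup (inflation lf j Z) j                  ≡⟨ lookup-applyWord-∉ w _ j∉w ⟨
      lookup (applyWord lf w (inflation lf j Z)) j ≡⟨ cong (λ V → lookup V j) fixed ⟩
      lookup Z j                                   ∎

  applyWord-fixed⇒inflation-fixed : ∀ {w Z i} → Unique w → applyWord lf w Z ≡ Z →
                                    i ∈ w → inflation lf i Z ≡ Z
  applyWord-fixed⇒inflation-fixed (j∉w ∷ _) fixed (here refl) = applyWord-fixed-head j∉w fixed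
  applyWord-fixed⇒inflation-fixed {j ∷ w} (j∉w ∷ unique) fixed (there i∈w) =
    applyWord-fixed⇒inflation-fixed unique
      (trans (cong (applyWord lf w) (sym (applyWord-fixed-head j∉w fixed))) fixed)
      i∈w

  inflation-fixed⇒applyWord-fixed : ∀ {Z} → (∀ i → inflation lf i Z ≡ Z) →
                                    ∀ w → applyWord lf w Z ≡ Z
  inflation-fixed⇒applyWord-fixed fixed []      = refl
  inflation-fixed⇒applyWord-fixed fixed (i ∷ w) =
    trans (cong (applyWord lf w) (fixed i)) (inflation-fixed⇒applyWord-fixed fixed w)

  sdsMap-fixed⇒inflation-fixed : ∀ π {Z} → sdsMap lf π Z ≡ Z → ∀ i → inflation lf i Z ≡ Z
  sdsMap-fixed⇒inflation-fixed π fixed i =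
    applyWord-fixed⇒inflation-fixed (tabulate⁺ (Injection.injective (↔⇒↣ π))) fixed
      (subst (_∈ tabulate (π ⟨$⟩ʳ_)) (inverseʳ π) (∈-tabulate⁺ (π ⟨$⟩ˡ i)))

  sdsMap-fixed-schedule-independent : ∀ π σ {Z} → sdsMap lf π Z ≡ Z → sdsMap lf σ Z ≡ Z
  sdsMap-fixed-schedule-independent π σ fixed =
    inflation-fixed⇒applyWord-fixed (sdsMap-fixed⇒inflation-fixed π fixed) (tabulate (σ ⟨$⟩ʳ_))

proposition3p2 : ∀ {n} (G : SimpleGraph n) (lf : LocalFunctions G) → Monotone lf →
    (π : Permutation′ n) →
    (∀ (X Z : State n) →
       sdsMap lf π Z ≡ Z →
       (X ≤ₛ Z ⊎ Z ≤ₛ X) →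
       ∃ (λ m → iter (sdsMap lf π) m X ≡ Z) →
       ∀ (Y : State n) → ((X ≤ₛ Y × Y ≤ₛ Z) ⊎ (Z ≤ₛ Y × Y ≤ₛ X)) →
       ∃ (λ m → iter (sdsMap lf π) m Y ≡ Z))
    ×
    (∀ (X Zπ : State n) →
       sdsMap lf π Zπ ≡ Zπ →
       (X ≤ₛ Zπ ⊎ Zπ ≤ₛ X) →
       ∃ (λ m → iter (sdsMap lf π) m X ≡ Zπ) →
       ∀ (σ : Permutation′ n) (k : ℕ) →
       (iter (sdsMap lf σ) k X ≤ₛ Zπ ⊎ Zπ ≤ₛ iter (sdsMap lf σ) k X))
proposition3p2 G lf mono π =
  (λ where
    X Z fixed _ (m , X↦Z) Y (inj₁ (X≤Y , Y≤Z)) →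
      m , iter-squeeze (sdsMap-mono lf mono π) m X≤Y Y≤Z X↦Z (iter-fixed fixed m)
    X Z fixed _ (m , X↦Z) Y (inj₂ (Z≤Y , Y≤X)) →
      m , iter-squeeze (sdsMap-mono lf mono π) m Z≤Y Y≤X (iter-fixed fixed m) X↦Z)
  ,
  λ X Z fixed X∼Z _ σ →
    iter-comparable-fixed (sdsMap-mono lf mono σ)
      (sdsMap-fixed-schedule-independent lf π σ fixed) X∼Z
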